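{- In the comparison model, for a fixed integer $k\ge 1$, any dynamic minimizer data structure maintaining a string $X$ of length $\ell$ over a general totally ordered alphabet cannot support substitution modifications (replacing the letter at an arbitrary position of $X$ by another letter) in $o(\log \ell)$ amortized time, where after each modification the structure must be able to answer minimizer queries.
   Context: For a string $X$ over a totally ordered alphabet and an integer $k\ge1$, with length-$k$ strings compared in the given order, the minimizer of $X$ is the smallest position at which a smallest length-$k$ substring of $X$ starts; a minimizer query returns this position. A minimizer data structure maintains $X$ under modifications and answers minimizer queries. -}

module Defs where

open import Data.Nat using (ℕ; zero; suc; _+_; _*_; _≤_; _<_; compare; Ordering)
open import Data.Nat.Logarithm using (⌊log₂_⌋)
open import Data.Fin using (Fin; toℕ)
open import Data.Vec using (Vec; lookup; toList; _[_]≔_)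
open import Data.List using (List; []; _∷_; _++_; [_]; take; drop; length)
open import Data.List.Relation.Unary.All using (All)
open import Data.Product using (_×_; _,_; proj₁; proj₂; Σ; ∃)
open import Relation.Binary.PropositionalEquality using (_≡_)

data Cmp : Set where
  lt eq gt : Cmp

cmpℕ : ℕ → ℕ → Cmp
cmpℕ a b with compare a b
... | Data.Nat.less _ _    = lt
... | Data.Nat.equal _     = eq
... | Data.Nat.greater _ _ = gt

-- Comparison-model decision tree over n letter handles (Fin n),
-- returning a value of type R.  Each internal node is one comparison.
data Tree (n : ℕ) (R : Set) : Set where
  leaf : R → Tree n R
  cmp  : Fin n → Fin n → (Cmp → Tree n R) → Tree n R

runT : ∀ {n R} → Tree n R → (Fin n → ℕ) → R × ℕ
runT (leaf r) v = r , 0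
runT (cmp i j f) v with runT (f (cmpℕ (v i) (v j))) v
... | r , c = r , suc c

data LexLe : List ℕ → List ℕ → Set where
  nil≤ : ∀ {ys} → LexLe [] ys
  lt≤  : ∀ {x y xs ys} → x < y → LexLe (x ∷ xs) (y ∷ ys)
  eq≤  : ∀ {x xs ys} → LexLe xs ys → LexLe (x ∷ xs) (x ∷ ys)

substr : (k : ℕ) → List ℕ → ℕ → List ℕ
substr k xs i = take k (drop i xs)

IsMinimizer : (k : ℕ) → List ℕ → ℕ → Set
IsMinimizer k X i =
  (i + k ≤ length X) ×
  (∀ j → j + k ≤ length X →
     LexLe (substr k X i) (substr k X j) × (substr k X j ≡ substr k X i → i ≤ j))

-- A dynamic minimizer data structure in the comparison model, for every
-- string length ℓ (substitutions keep the length).  Letters are only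
-- accessible through handles: handles 0..ℓ-1 are the initial letters,
-- handle ℓ+t is the new letter of the t-th substitution (0-based).
-- The structure may keep any information in its state, but learns
-- about letters only through comparisons.
record DS : Set₁ where
  field
    State  : ℕ → Set
    init   : (ℓ : ℕ) → Tree ℓ (State ℓ)
    update : (ℓ t : ℕ) → State ℓ → Fin ℓ → Tree (ℓ + suc t) (State ℓ)
    answer : (ℓ : ℕ) → State ℓ → ℕ

nth : List ℕ → ℕ → ℕ
nth []       _       = 0
nth (x ∷ xs) zero    = x
nth (x ∷ xs) (suc n) = nth xs n

module _ (D : DS) (ℓ : ℕ) where
  open DS D

  go : ℕ → List ℕ → State ℓ → Vec ℕ ℓ → List (Fin ℓ × ℕ)
     → List (State ℓ × Vec ℕ ℓ) × ℕ
  go t hist s w [] = [] , 0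
  go t hist s w ((p , a) ∷ us) with runT (update ℓ t s p) (λ i → nth (hist ++ [ a ]) (toℕ i))
  ... | s' , c with go (suc t) (hist ++ [ a ]) s' (w [ p ]≔ a) us
  ... | tr , c₂ = ((s' , w [ p ]≔ a) ∷ tr) , c + c₂

  exec : Vec ℕ ℓ → List (Fin ℓ × ℕ) → List (State ℓ × Vec ℕ ℓ) × ℕ
  exec x us with runT (init ℓ) (lookup x)
  ... | s₀ , c₀ with go 0 (toList x) s₀ x us
  ... | tr , c = ((s₀ , x) ∷ tr) , c₀ + c

  cost : Vec ℕ ℓ → List (Fin ℓ × ℕ) → ℕ
  cost x us = proj₂ (exec x us)

Correct : ℕ → DS → Set
Correct k D = ∀ ℓ → k ≤ ℓ → (x : Vec ℕ ℓ) → (us : List (Fin ℓ × ℕ)) →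
  All (λ sw → IsMinimizer k (toList (proj₂ sw)) (DS.answer D ℓ (proj₁ sw)))
      (proj₁ (exec D ℓ x us))

-- Amortized cost per substitution at length ℓ is at most (num/den)·log₂ ℓ:
-- for some (ℓ-dependent, initial-potential) constant P, every run with m
-- substitutions uses at most m·(num/den)·⌊log₂ ℓ⌋ + P comparisons.
AmortizedWithin : DS → (ℓ num den : ℕ) → Set
AmortizedWithin D ℓ num den = ∃ λ P → (x : Vec ℕ ℓ) → (us : List (Fin ℓ × ℕ)) →
  den * cost D ℓ x us ≤ num * length us * ⌊log₂ ℓ ⌋ + P

LittleOLog : DS → Set
LittleOLog D = ∀ num den → 0 < num → 0 < den →
  ∃ λ ℓ₀ → ∀ ℓ → ℓ₀ ≤ ℓ → AmortizedWithin D ℓ num den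

-- The adversary encodes an arbitrary schedule p₀ … p_M of positions below n:
-- at time t every position holds the time of its next selection, so p_t is
-- the unique least letter and hence the minimizer, and the t-th substitution
-- writes the next selection time of p_t at p_t.  As every substitution happens
-- at the position the structure has just reported, the whole run is one
-- comparison tree, independent of the schedule, which outputs the schedule.
-- It therefore needs (M + 1) log₃ n comparisons on some schedule, whereas
-- amortized cost (1/4) log₂ ℓ per substitution allows only about
-- M log₂ (2n) / 4 plus the initial potential P; taking M > P gives a contradiction.
module Submission where

open import Defs
open import Data.Nat
open import Data.Nat.Properties
open import Data.Nat.DivMod using (_mod_; m<n⇒m%n≡m; m/n*n≤m; m*n/n≡m; /-monoˡ-≤)
open import Data.Nat.Logarithm using (⌊log₂[2^n]⌋≡n)
open import Data.Fin as Fin using (Fin; toℕ; fromℕ<; remQuot; combine)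
open import Data.Fin.Properties using (toℕ<n; toℕ-injective; toℕ-fromℕ<; combine-remQuot; injective⇒≤)
open import Data.Vec as Vec using (Vec; tabulate; toList; _[_]≔_)
open import Data.Vec.Properties using (lookup∘tabulate; tabulate∘lookup; tabulate-cong; length-toList; lookup∘update; lookup∘update′)
open import Data.List as List using (List; []; _∷_; _++_; [_]; length)
open import Data.List.Properties using (length-++; ++-assoc; ∷-injective)
open import Data.List.Membership.Propositional using (_∈_)
open import Data.List.Relation.Unary.All as All using (All; []; _∷_)
open import Data.List.Membership.Propositional.Properties using (∈-++⁺ˡ; ∈-++⁺ʳ)
open import Data.List.Relation.Unary.Any using (here; index)
open import Data.List.Relation.Unary.Any.Properties using (lookup-index)
open import Data.Nat.Tactic.RingSolver using (solve-∀)
open import Data.Product using (Σ; _×_; _,_; proj₁; proj₂; map₂)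
open import Data.Unit using (⊤; tt)
open import Data.Empty using (⊥)
open import Function using (_∘_)
open import Relation.Binary.PropositionalEquality hiding ([_])
open import Relation.Nullary using (¬_; yes; no; contradiction)

-- Comparison trees

-- Handles are plain numbers: a run of a data structure compares letters
-- created by ever later substitutions, so no single bound on them exists.
data DTree (R : Set) : Set where
  done : R → DTree R
  ask  : ℕ → ℕ → (Cmp → DTree R) → DTree R

run : ∀ {R} → DTree R → (ℕ → ℕ) → R × ℕ
run (done r)    v = r , 0
run (ask i j f) v = map₂ suc (run (f (cmpℕ (v i) (v j))) v)

widen : ∀ {n R} → Tree n R → DTree R
widen (leaf r)    = done r
widen (cmp i j f) = ask (toℕ i) (toℕ j) (λ c → widen (f c))

run-widen : ∀ {n R} (t : Tree n R) {v : ℕ → ℕ} {w : Fin n → ℕ} →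
            (∀ i → v (toℕ i) ≡ w i) → run (widen t) v ≡ runT t w
run-widen (leaf r)    v≗w = refl
run-widen (cmp i j f) {v} {w} v≗w rewrite v≗w i | v≗w j
  with runT (f (cmpℕ (w i) (w j))) w | run-widen (f (cmpℕ (w i) (w j))) v≗w
... | r , c | e = cong (map₂ suc) e

_>>=_ : ∀ {A B} → DTree A → (A → DTree B) → DTree B
done a    >>= g = g a
ask i j f >>= g = ask i j (λ c → f c >>= g)

run->>= : ∀ {A B} (t : DTree A) {g : A → DTree B} {v a b c c′} →
          run t v ≡ (a , c) → run (g a) v ≡ (b , c′) → run (t >>= g) v ≡ (b , c + c′)
run->>= (done a)    refl e = e
run->>= (ask i j f) {v = v} e₁ e₂ with run (f (cmpℕ (v i) (v j))) v in e
run->>= (ask i j f) refl e₂ | a , c = cong (map₂ suc) (run->>= (f _) e e₂)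

run-cons : ∀ {A} (x : A) (t : DTree (List A)) {v xs c} →
           run t v ≡ (xs , c) → run (t >>= λ ys → done (x ∷ ys)) v ≡ (x ∷ xs , c)
run-cons x t {c = c} e = trans (run->>= t e refl) (cong (_ ,_) (+-identityʳ c))

outcomes : ∀ {R} → ℕ → DTree R → List R
outcomes d       (done r)    = [ r ]
outcomes zero    (ask i j f) = []
outcomes (suc d) (ask i j f) = outcomes d (f lt) ++ outcomes d (f eq) ++ outcomes d (f gt)

length-outcomes : ∀ {R} d (t : DTree R) → length (outcomes d t) ≤ 3 ^ d
length-outcomes d       (done r)    = m^n>0 3 d
length-outcomes zero    (ask i j f) = z≤n
length-outcomes (suc d) (ask i j f) = begin
  length (outcomes d (f lt) ++ outcomes d (f eq) ++ outcomes d (f gt))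
    ≡⟨ length-++ (outcomes d (f lt)) ⟩
  length (outcomes d (f lt)) + length (outcomes d (f eq) ++ outcomes d (f gt))
    ≡⟨ cong (length (outcomes d (f lt)) +_) (length-++ (outcomes d (f eq))) ⟩
  length (outcomes d (f lt)) + (length (outcomes d (f eq)) + length (outcomes d (f gt)))
    ≤⟨ +-mono-≤ (length-outcomes d (f lt))
         (+-mono-≤ (length-outcomes d (f eq)) (≤-trans (length-outcomes d (f gt)) (m≤m+n _ 0))) ⟩
  3 ^ d + (3 ^ d + (3 ^ d + 0)) ∎
  where open ≤-Reasoning

run∈outcomes : ∀ {R} d (t : DTree R) v → proj₂ (run t v) ≤ d → proj₁ (run t v) ∈ outcomes d t
run∈outcomes d       (done r)    v _ = here refl
run∈outcomes (suc d) (ask i j f) v c≤ with cmpℕ (v i) (v j)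
... | lt = ∈-++⁺ˡ (run∈outcomes d (f lt) v (s≤s⁻¹ c≤))
... | eq = ∈-++⁺ʳ (outcomes d (f lt)) (∈-++⁺ˡ (run∈outcomes d (f eq) v (s≤s⁻¹ c≤)))
... | gt = ∈-++⁺ʳ (outcomes d (f lt)) (∈-++⁺ʳ (outcomes d (f eq)) (run∈outcomes d (f gt) v (s≤s⁻¹ c≤)))

digits : ∀ n m → Fin (n ^ m) → List ℕ
digits n zero    i = []
digits n (suc m) i = toℕ (proj₁ (remQuot {n} (n ^ m) i)) ∷ digits n m (proj₂ (remQuot {n} (n ^ m) i))

digits-injective : ∀ n m {i j} → digits n m i ≡ digits n m j → i ≡ j
digits-injective n zero    {Fin.zero} {Fin.zero} _ = refl
digits-injective n (suc m) {i} {j} e with ∷-injective e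
... | q≡q , r≡r = begin
  i                                        ≡⟨ combine-remQuot {n} (n ^ m) i ⟨
  combine (proj₁ qr-i) (proj₂ qr-i)        ≡⟨ cong₂ (combine {n}) (toℕ-injective q≡q) (digits-injective n m r≡r) ⟩
  combine (proj₁ qr-j) (proj₂ qr-j)        ≡⟨ combine-remQuot {n} (n ^ m) j ⟩
  j                                        ∎
  where
  open ≡-Reasoning
  qr-i = remQuot {n} (n ^ m) i
  qr-j = remQuot {n} (n ^ m) j

length-digits : ∀ n m i → length (digits n m i) ≡ m
length-digits n zero    i = refl
length-digits n (suc m) i = cong suc (length-digits n m _)

digits< : ∀ n m i → All (_< n) (digits n m i)
digits< n zero    i = []
digits< n (suc m) i = toℕ<n _ ∷ digits< n m _

outputs-all-digits⇒^≤3^ : ∀ {n m d} (t : DTree (List ℕ)) →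
  (∀ i → Σ (ℕ → ℕ) λ v → proj₁ (run t v) ≡ digits n m i × proj₂ (run t v) ≤ d) →
  n ^ m ≤ 3 ^ d
outputs-all-digits⇒^≤3^ {n} {m} {d} t realise = ≤-trans (injective⇒≤ position-injective) (length-outcomes d t)
  where
  reached : ∀ i → digits n m i ∈ outcomes d t
  reached i with realise i
  ... | v , out , c≤d = subst (_∈ outcomes d t) out (run∈outcomes d t v c≤d)
  position : Fin (n ^ m) → Fin (length (outcomes d t))
  position i = index (reached i)
  position-injective : ∀ {i j} → position i ≡ position j → i ≡ j
  position-injective {i} {j} e = digits-injective n m
    (trans (lookup-index (reached i)) (trans (cong (List.lookup (outcomes d t)) e) (sym (lookup-index (reached j)))))

-- Minimizers

nth-++ˡ : ∀ xs ys {j} → j < length xs → nth (xs ++ ys) j ≡ nth xs j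
nth-++ˡ (x ∷ xs) ys {zero}  _   = refl
nth-++ˡ (x ∷ xs) ys {suc j} j<n = nth-++ˡ xs ys (s≤s⁻¹ j<n)

nth-toList : ∀ {n} (w : Vec ℕ n) (i : Fin n) → nth (toList w) (toℕ i) ≡ Vec.lookup w i
nth-toList (x Vec.∷ w) Fin.zero    = refl
nth-toList (x Vec.∷ w) (Fin.suc i) = nth-toList w i

nth-toList-tabulate : ∀ {n} (f : ℕ → ℕ) {j} → j < n → nth (toList (tabulate {n = n} (f ∘ toℕ))) j ≡ f j
nth-toList-tabulate {n} f {j} j<n = begin
  nth (toList w) j                   ≡⟨ cong (nth (toList w)) (toℕ-fromℕ< j<n) ⟨
  nth (toList w) (toℕ (fromℕ< j<n))  ≡⟨ nth-toList w (fromℕ< j<n) ⟩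
  Vec.lookup w (fromℕ< j<n)          ≡⟨ lookup∘tabulate (f ∘ toℕ) (fromℕ< j<n) ⟩
  f (toℕ (fromℕ< j<n))               ≡⟨ cong f (toℕ-fromℕ< j<n) ⟩
  f j                                ∎
  where
  open ≡-Reasoning
  w : Vec ℕ n
  w = tabulate (f ∘ toℕ)

substr-suc : ∀ k X {j} → j < length X → substr (suc k) X j ≡ nth X j ∷ substr k X (suc j)
substr-suc k (x ∷ X) {zero}  _   = refl
substr-suc k (x ∷ X) {suc j} j<n = substr-suc k X (s≤s⁻¹ j<n)

LexLe-head : ∀ {u v us vs} → LexLe (u ∷ us) (v ∷ vs) → u ≤ v
LexLe-head (lt≤ u<v) = <⇒≤ u<v
LexLe-head (eq≤ _)   = ≤-refl

-- For k ≥ 1 the first letter already separates the substring at x from all others.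
minimizer-at-unique-least : ∀ {k X i x} → 1 ≤ k → IsMinimizer k X i → x + k ≤ length X →
  (∀ j → j < length X → nth X x ≤ nth X j) →
  (∀ j → j < length X → nth X j ≡ nth X x → j ≡ x) → i ≡ x
minimizer-at-unique-least {suc k} {X} {i} {x} _ (i+k≤ , minimal) x+k≤ least unique =
  unique i i< (≤-antisym Xi≤Xx (least i i<))
  where
  i< : i < length X
  i< = <-≤-trans (m<m+n i (s≤s z≤n)) i+k≤
  x< : x < length X
  x< = <-≤-trans (m<m+n x (s≤s z≤n)) x+k≤
  Xi≤Xx : nth X i ≤ nth X x
  Xi≤Xx = LexLe-head (subst₂ LexLe (substr-suc k X i<) (substr-suc k X x<) (proj₁ (minimal x x+k≤)))

-- Running a structure on its own answers

module Replay (D : DS) (ℓ : ℕ) .{{_ : NonZero ℓ}} where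
  open DS D

  trace : ℕ → List ℕ → State ℓ → Vec ℕ ℓ → List (Fin ℓ × ℕ) → List (State ℓ × Vec ℕ ℓ)
  trace t hist s w us = (s , w) ∷ proj₁ (go D ℓ t hist s w us)

  go-∷ : ∀ t hist s w p a us →
    let hist′    = hist ++ [ a ]
        (s′ , c) = runT (update ℓ t s p) (nth hist′ ∘ toℕ)
        (_ , c′) = go D ℓ (suc t) hist′ s′ (w [ p ]≔ a) us
    in go D ℓ t hist s w ((p , a) ∷ us) ≡ (trace (suc t) hist′ s′ (w [ p ]≔ a) us , c + c′)
  go-∷ t hist s w p a us with runT (update ℓ t s p) (nth (hist ++ [ a ]) ∘ toℕ)
  ... | s′ , c with go D ℓ (suc t) (hist ++ [ a ]) s′ (w [ p ]≔ a) us
  ... | _ = refl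

  exec-unfold : ∀ x us →
    let (s₀ , c₀) = runT (init ℓ) (Vec.lookup x)
    in exec D ℓ x us ≡ (trace 0 (toList x) s₀ x us , c₀ + proj₂ (go D ℓ 0 (toList x) s₀ x us))
  exec-unfold x us with runT (init ℓ) (Vec.lookup x)
  ... | s₀ , c₀ with go D ℓ 0 (toList x) s₀ x us
  ... | _ = refl

  exec-trace : ∀ x us →
    proj₁ (exec D ℓ x us) ≡ trace 0 (toList x) (proj₁ (runT (init ℓ) (Vec.lookup x))) x us
  exec-trace x us = cong proj₁ (exec-unfold x us)

  -- Handle i < ℓ reads the i-th initial letter and handle ℓ + t the letter of the t-th substitution.
  letters : Vec ℕ ℓ → List (Fin ℓ × ℕ) → ℕ → ℕ
  letters x us = nth (toList x ++ List.map proj₂ us)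

  answers : List (State ℓ × Vec ℕ ℓ) → List ℕ
  answers = List.map (answer ℓ ∘ proj₁)

  AnswerDriven : List (State ℓ × Vec ℕ ℓ) → List (Fin ℓ × ℕ) → Set
  AnswerDriven ((s , _) ∷ [])            []             = ⊤
  AnswerDriven ((s , _) ∷ rest@(_ ∷ _)) ((p , _) ∷ us) = p ≡ answer ℓ s mod ℓ × AnswerDriven rest us
  AnswerDriven _                         _              = ⊥

  -- Substituting at the position just reported needs no knowledge of the
  -- schedule, so one tree serves every run that is driven by the answers.
  replay : ℕ → ℕ → State ℓ → DTree (List ℕ)
  replay t zero    s = done [ answer ℓ s ]
  replay t (suc m) s = (widen (update ℓ t s (answer ℓ s mod ℓ)) >>= replay (suc t) m)
                         >>= λ as → done (answer ℓ s ∷ as)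

  replayRun : ℕ → DTree (List ℕ)
  replayRun m = widen (init ℓ) >>= replay 0 m

  run-replay : ∀ t hist s w us F → F ≡ hist ++ List.map proj₂ us → length hist ≡ ℓ + t →
    AnswerDriven (trace t hist s w us) us →
    run (replay t (length us) s) (nth F) ≡ (answers (trace t hist s w us) , proj₂ (go D ℓ t hist s w us))
  run-replay t hist s w []                                 F F≡ len tt = refl
  run-replay t hist s w ((.(answer ℓ s mod ℓ) , a) ∷ us) F F≡ len (refl , driven)
    rewrite go-∷ t hist s w (answer ℓ s mod ℓ) a us =
    run-cons (answer ℓ s) _ (run->>= (widen (update ℓ t s _)) (run-widen _ agrees)
      (run-replay (suc t) hist′ _ _ us F F≡′ len′ driven))
    where
    hist′ = hist ++ [ a ]
    F≡′ : F ≡ hist′ ++ List.map proj₂ us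
    F≡′ = trans F≡ (sym (++-assoc hist [ a ] _))
    len′ : length hist′ ≡ ℓ + suc t
    len′ = trans (length-++ hist) (trans (cong (_+ 1) len) (trans (+-assoc ℓ t 1) (cong (ℓ +_) (+-comm t 1))))
    agrees : ∀ (i : Fin (ℓ + suc t)) → nth F (toℕ i) ≡ nth hist′ (toℕ i)
    agrees i = trans (cong (λ G → nth G (toℕ i)) F≡′)
                  (nth-++ˡ hist′ _ (subst (toℕ i <_) (sym len′) (toℕ<n i)))

  run-replayRun : ∀ x us → AnswerDriven (proj₁ (exec D ℓ x us)) us →
    run (replayRun (length us)) (letters x us) ≡ (answers (proj₁ (exec D ℓ x us)) , cost D ℓ x us)
  run-replayRun x us driven rewrite exec-unfold x us =
    run->>= (widen (init ℓ)) (run-widen (init ℓ) agrees)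
      (run-replay 0 (toList x) _ x us _ refl (trans (length-toList x) (sym (+-identityʳ ℓ))) driven)
    where
    agrees : ∀ i → letters x us (toℕ i) ≡ Vec.lookup x i
    agrees i = trans (nth-++ˡ (toList x) _ (subst (toℕ i <_) (sym (length-toList x)) (toℕ<n i)))
                  (nth-toList x i)

-- The adversary

module Schedule (ℓ : ℕ) .{{_ : NonZero ℓ}} where

  toℕ-mod : ∀ {x} → x < ℓ → toℕ (x mod ℓ) ≡ x
  toℕ-mod x<ℓ = trans (toℕ-fromℕ< _) (m<n⇒m%n≡m x<ℓ)

  -- The time at which the schedule s, started at time b, next selects
  -- position p; positions it never selects get the time at which s ends.
  nextUse : List ℕ → ℕ → ℕ → ℕ
  nextUse []      b p = b
  nextUse (x ∷ s) b p with x ≟ p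
  ... | yes _ = b
  ... | no  _ = nextUse s (suc b) p

  b≤nextUse : ∀ s b p → b ≤ nextUse s b p
  b≤nextUse []      b p = ≤-refl
  b≤nextUse (x ∷ s) b p with x ≟ p
  ... | yes _ = ≤-refl
  ... | no  _ = ≤-trans (n≤1+n b) (b≤nextUse s (suc b) p)

  nextUse-here : ∀ x s b → nextUse (x ∷ s) b x ≡ b
  nextUse-here x s b with x ≟ x
  ... | yes _   = refl
  ... | no  x≢x = contradiction refl x≢x

  nextUse-there : ∀ {x p} s b → ¬ x ≡ p → nextUse (x ∷ s) b p ≡ nextUse s (suc b) p
  nextUse-there {x} {p} s b x≢p with x ≟ p
  ... | yes x≡p = contradiction x≡p x≢p
  ... | no  _   = refl

  nextUse≡now : ∀ x s b p → nextUse (x ∷ s) b p ≡ b → p ≡ x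
  nextUse≡now x s b p e with x ≟ p
  ... | yes x≡p = sym x≡p
  ... | no  _   = contradiction (subst (suc b ≤_) e (b≤nextUse s (suc b) p)) (1+n≰n {b})

  encode : List ℕ → ℕ → Vec ℕ ℓ
  encode s b = tabulate (λ i → nextUse s b (toℕ i))

  substitutions : List ℕ → ℕ → List (Fin ℓ × ℕ)
  substitutions []           b = []
  substitutions (x ∷ [])     b = []
  substitutions (x ∷ y ∷ s) b = (x mod ℓ , nextUse (y ∷ s) (suc b) x) ∷ substitutions (y ∷ s) (suc b)

  length-substitutions : ∀ x s b → length (substitutions (x ∷ s) b) ≡ length s
  length-substitutions x []      b = refl
  length-substitutions x (y ∷ s) b = cong suc (length-substitutions y s (suc b))

  encode-step : ∀ {x} y s b → x < ℓ →
    encode (x ∷ y ∷ s) b [ x mod ℓ ]≔ nextUse (y ∷ s) (suc b) x ≡ encode (y ∷ s) (suc b)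
  encode-step {x} y s b x<ℓ =
    trans (sym (tabulate∘lookup _)) (tabulate-cong pointwise)
    where
    pointwise : ∀ i → Vec.lookup (encode (x ∷ y ∷ s) b [ x mod ℓ ]≔ nextUse (y ∷ s) (suc b) x) i
                      ≡ nextUse (y ∷ s) (suc b) (toℕ i)
    pointwise i with x mod ℓ Fin.≟ i
    ... | yes refl = trans (lookup∘update (x mod ℓ) (encode (x ∷ y ∷ s) b) _)
                       (cong (nextUse (y ∷ s) (suc b)) (sym (toℕ-mod x<ℓ)))
    ... | no  x≢i  = trans (lookup∘update′ (x≢i ∘ sym) (encode (x ∷ y ∷ s) b) _)
                       (trans (lookup∘tabulate (nextUse (x ∷ y ∷ s) b ∘ toℕ) i)
                         (nextUse-there (y ∷ s) b (λ x≡i → x≢i (toℕ-injective (trans (toℕ-mod x<ℓ) x≡i)))))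

  minimizer-encode : ∀ {k x s b i} → 1 ≤ k → x + k ≤ ℓ →
    IsMinimizer k (toList (encode (x ∷ s) b)) i → i ≡ x
  minimizer-encode {k} {x} {s} {b} 1≤k x+k≤ℓ minimizer =
    minimizer-at-unique-least 1≤k minimizer (subst (x + k ≤_) (sym length≡ℓ) x+k≤ℓ) least unique
    where
    X = toList (encode (x ∷ s) b)
    length≡ℓ : length X ≡ ℓ
    length≡ℓ = length-toList (encode (x ∷ s) b)
    letter : ∀ {j} → j < length X → nth X j ≡ nextUse (x ∷ s) b j
    letter j< = nth-toList-tabulate (nextUse (x ∷ s) b) (subst (_ <_) length≡ℓ j<)
    x< : x < length X
    x< = subst (x <_) (sym length≡ℓ) (<-≤-trans (m<m+n x 1≤k) x+k≤ℓ)
    Xx≡b : nth X x ≡ b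
    Xx≡b = trans (letter x<) (nextUse-here x s b)
    least : ∀ j → j < length X → nth X x ≤ nth X j
    least j j< = subst₂ _≤_ (sym Xx≡b) (sym (letter j<)) (b≤nextUse (x ∷ s) b j)
    unique : ∀ j → j < length X → nth X j ≡ nth X x → j ≡ x
    unique j j< e = nextUse≡now x s b j (trans (sym (letter j<)) (trans e Xx≡b))

module Adversary (D : DS) {k : ℕ} (1≤k : 1 ≤ k) (ℓ : ℕ) .{{_ : NonZero ℓ}} where
  open DS D
  open Schedule ℓ
  open Replay D ℓ

  Reports : State ℓ × Vec ℕ ℓ → Set
  Reports sw = IsMinimizer k (toList (proj₂ sw)) (answer ℓ (proj₁ sw))

  follows-schedule : ∀ x r b hist st → All (λ y → y + k ≤ ℓ) (x ∷ r) →
    let tr = trace b hist st (encode (x ∷ r) b) (substitutions (x ∷ r) b) in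
    All Reports tr → answers tr ≡ x ∷ r × AnswerDriven tr (substitutions (x ∷ r) b)
  follows-schedule x [] b hist st (x+k≤ℓ ∷ _) (reports ∷ _) =
    cong (_∷ []) (minimizer-encode 1≤k x+k≤ℓ reports) , tt
  follows-schedule x (y ∷ r) b hist st (x+k≤ℓ ∷ valid) (reports ∷ rest)
    rewrite go-∷ b hist st (encode (x ∷ y ∷ r) b) (x mod ℓ) (nextUse (y ∷ r) (suc b) x) (substitutions (y ∷ r) (suc b))
          | encode-step y r b (<-≤-trans (m<m+n x 1≤k) x+k≤ℓ)
    with follows-schedule y r (suc b) _ _ valid rest
  ... | answers≡ , driven =
    cong₂ _∷_ answer≡x answers≡ , cong (_mod ℓ) (sym answer≡x) , driven
    where
    answer≡x : answer ℓ st ≡ x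
    answer≡x = minimizer-encode 1≤k x+k≤ℓ reports

  realise-schedule : Correct k D → ∀ x r → All (λ y → y + k ≤ ℓ) (x ∷ r) →
    let w  = encode (x ∷ r) 0
        us = substitutions (x ∷ r) 0
    in run (replayRun (length r)) (letters w us) ≡ (x ∷ r , cost D ℓ w us)
  realise-schedule correct x r valid@(x+k≤ℓ ∷ _) =
    subst₂ (λ m out → run (replayRun m) (letters w us) ≡ (out , cost D ℓ w us))
      (length-substitutions x r 0) answers≡ (run-replayRun w us driven)
    where
    w  = encode (x ∷ r) 0
    us = substitutions (x ∷ r) 0
    trace≡ = exec-trace w us
    reports : All Reports (trace 0 (toList w) _ w us)
    reports = subst (All Reports) trace≡ (correct ℓ (m+n≤o⇒n≤o x x+k≤ℓ) w us)
    followed = follows-schedule x r 0 _ _ valid reports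
    answers≡ : answers (proj₁ (exec D ℓ w us)) ≡ x ∷ r
    answers≡ = subst (λ tr → answers tr ≡ x ∷ r) (sym trace≡) (proj₁ followed)
    driven : AnswerDriven (proj₁ (exec D ℓ w us)) us
    driven = subst (λ tr → AnswerDriven tr us) (sym trace≡) (proj₂ followed)

  cost-lower-bound : Correct k D → ∀ {n M d} → n + k ≤ ℓ →
    (∀ x us → length us ≡ M → cost D ℓ x us ≤ d) → n ^ suc M ≤ 3 ^ d
  cost-lower-bound correct {n} {M} {d} n+k≤ℓ cheap = outputs-all-digits⇒^≤3^ (replayRun M) realise
    where
    realise : ∀ i → Σ (ℕ → ℕ) λ v → proj₁ (run (replayRun M) v) ≡ digits n (suc M) i
                                  × proj₂ (run (replayRun M) v) ≤ d
    realise i = _ , cong proj₁ realised , subst (_≤ d) (sym (cong proj₂ realised)) (cheap w us length≡)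
      where
      x = toℕ (proj₁ (remQuot {n} (n ^ M) i))
      r = digits n M (proj₂ (remQuot {n} (n ^ M) i))
      valid : All (λ y → y + k ≤ ℓ) (x ∷ r)
      valid = All.map (λ y<n → <⇒≤ (<-≤-trans (+-monoˡ-< k y<n) n+k≤ℓ)) (digits< n (suc M) i)
      w  = encode (x ∷ r) 0
      us = substitutions (x ∷ r) 0
      length≡ : length us ≡ M
      length≡ = trans (length-substitutions x r 0) (length-digits n M _)
      realised : run (replayRun M) (letters w us) ≡ (x ∷ r , cost D ℓ w us)
      realised = subst (λ m → run (replayRun m) (letters w us) ≡ (x ∷ r , cost D ℓ w us))
                   (length-digits n M _) (realise-schedule correct x r valid)

3^<2^ : ∀ {L M P d} → 2 ≤ L → P ≤ M → 4 * d ≤ M * suc L + P → 3 ^ d < 2 ^ (L * suc M)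
3^<2^ {L} {M} {P} {d} 2≤L P≤M 4d≤ = begin-strict
  3 ^ d         ≤⟨ ^-monoˡ-≤ d (s≤s (s≤s (s≤s z≤n))) ⟩
  (2 ^ 2) ^ d   ≡⟨ ^-*-assoc 2 2 d ⟩
  2 ^ (2 * d)   <⟨ ^-monoʳ-< 2 (s≤s (s≤s z≤n)) (*-cancelˡ-< 2 (2 * d) (L * suc M) 4d<) ⟩
  2 ^ (L * suc M) ∎
  where
  open ≤-Reasoning
  regroup₁ : ∀ L M → M * suc L + M ≡ L * M + 2 * M
  regroup₁ = solve-∀
  regroup₂ : ∀ L M → L * M + L * M + 2 * L ≡ 2 * (L * suc M)
  regroup₂ = solve-∀
  4d< : 2 * (2 * d) < 2 * (L * suc M)
  4d< = begin-strict
    2 * (2 * d)     ≡⟨ *-assoc 2 2 d ⟨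
    4 * d           ≤⟨ 4d≤ ⟩
    M * suc L + P   ≤⟨ +-monoʳ-≤ (M * suc L) P≤M ⟩
    M * suc L + M   ≡⟨ regroup₁ L M ⟩
    L * M + 2 * M   ≤⟨ +-monoʳ-≤ (L * M) (*-monoˡ-≤ M 2≤L) ⟩
    L * M + L * M   <⟨ m<m+n (L * M + L * M) (*-monoʳ-< 2 {0} {L} (<-≤-trans (s≤s z≤n) 2≤L)) ⟩
    L * M + L * M + 2 * L ≡⟨ regroup₂ L M ⟩
    2 * (L * suc M) ∎

n<2^n : ∀ n → n < 2 ^ n
n<2^n zero    = s≤s z≤n
n<2^n (suc n) = +-mono-≤ (m^n>0 2 n) (≤-trans (n<2^n n) (m≤m+n (2 ^ n) 0))

*≤⇒≤/ : ∀ {c b} den .{{_ : NonZero den}} → den * c ≤ b → c ≤ b / den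
*≤⇒≤/ {c} {b} den le = subst (_≤ b / den) (m*n/n≡m c den) (/-monoˡ-≤ den (subst (_≤ b) (*-comm den c) le))

lemma4 : (k : ℕ) → 1 ≤ k → (D : DS) → Correct k D → ¬ LittleOLog D
lemma4 k 1≤k D correct fast with fast 1 4 (s≤s z≤n) (s≤s z≤n)
... | ℓ₀ , amortized = <⇒≱ (3^<2^ {d = d} (s≤s (s≤s z≤n)) (n≤1+n P) 4d≤B) 2^≤3^
  where
  L = suc (suc (ℓ₀ + k))
  ℓ = 2 ^ suc L
  instance _ = m^n≢0 2 (suc L)
  ℓ₀≤ℓ : ℓ₀ ≤ ℓ
  ℓ₀≤ℓ = <⇒≤ (≤-<-trans (≤-trans (m≤m+n ℓ₀ k) (m≤n+m (ℓ₀ + k) 3)) (n<2^n (suc L)))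
  k≤2^L : k ≤ 2 ^ L
  k≤2^L = <⇒≤ (≤-<-trans (≤-trans (m≤n+m k ℓ₀) (m≤n+m (ℓ₀ + k) 2)) (n<2^n L))
  P = proj₁ (amortized ℓ ℓ₀≤ℓ)
  M = suc P
  d = (M * suc L + P) / 4
  4d≤B : 4 * d ≤ M * suc L + P
  4d≤B = subst (_≤ M * suc L + P) (*-comm d 4) (m/n*n≤m (M * suc L + P) 4)
  cheap : ∀ x us → length us ≡ M → cost D ℓ x us ≤ d
  cheap x us length≡M = *≤⇒≤/ 4 (subst (λ B → 4 * cost D ℓ x us ≤ B + P)
    (cong₂ _*_ (trans (*-identityˡ (length us)) length≡M) (⌊log₂[2^n]⌋≡n (suc L)))
    (proj₂ (amortized ℓ ℓ₀≤ℓ) x us))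
  2^≤3^ : 2 ^ (L * suc M) ≤ 3 ^ d
  2^≤3^ = subst (_≤ 3 ^ d) (^-*-assoc 2 L (suc M))
    (Adversary.cost-lower-bound D 1≤k ℓ correct (+-monoʳ-≤ (2 ^ L) (≤-trans k≤2^L (m≤m+n (2 ^ L) 0))) cheap)
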